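{- Let $S$ be a set of $n$ keys, let $P$ be a static binary search tree of minimum height on $S$ (the reference tree), with its current partition into preferred paths, and let $T$ be a hybrid tree representing these preferred paths. Then $d_T(x)=O(d_P(x))$ for all $x\in S$, where $d_T(x)$ and $d_P(x)$ denote the depth of $x$ in $T$ and in $P$, respectively. In particular, $T$ has height $O(\log n)$.
   Context: Reference tree and preferred paths: $P$ is a fixed static BST of minimum height on $S$. For an internal node $y$ of $P$, its preferred child is its left or right child according to whether the most recent access to a key in the subtree of $P$ rooted at $y$ was to a key in the left subtree of $y$ (including $y$ itself) or in its right subtree. A preferred path is a maximal chain of preferred children; the preferred paths partition $S$, each having $O(\log n)$ nodes. Hybrid tree: each preferred path is represented by a binary search tree on its nodes consisting of a top path, namely the topmost (smallest depth in $P$) nodes of the preferred path, stored exactly as they appear on the path (each node linked to the next by the same left/right child link as in $P$), of length in $[\log\log n, 3\log\log n]$, and a bottom tree, namely the remaining nodes of the path stored as a red-black tree (hence of height $O(\log\log n)$), attached below the last node of the top path; if there is no bottom tree, the top path has length in $[0, 3\log\log n]$. The hybrid tree $T$ is the binary search tree on $S$ obtained by linking these representations together: the representation of a preferred path hangs, at the position determined by in-order, below the representation of the preferred path containing the parent (in $P$) of its topmost node, and the representation containing the root of $P$ is at the top. -}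

module Defs where

open import Data.Nat using (ℕ; zero; suc; _+_; _*_; _≤_; _<_; _⊔_; _≤?_)
open import Data.Nat.Properties using (_≟_)
open import Data.Nat.Logarithm using (⌊log₂_⌋)
open import Data.Bool using (Bool; true; false)
open import Data.Maybe using (Maybe; just; nothing)
open import Data.List using (List; []; _∷_; _++_; [_]; length; map)
open import Data.List.Membership.DecPropositional _≟_ using (_∈?_)
open import Data.List.Relation.Binary.Permutation.Propositional using (_↭_)
open import Data.List.Relation.Binary.Pointwise using (Pointwise)
open import Data.Product using (Σ; _×_; _,_; proj₁; proj₂)
open import Data.Sum using (_⊎_)
open import Relation.Nullary using (yes; no)
open import Relation.Binary.PropositionalEquality using (_≡_)

data Tree : Set where
  leaf : Tree
  node : Tree → ℕ → Tree → Tree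

inorder : Tree → List ℕ
inorder leaf = []
inorder (node l y r) = inorder l ++ (y ∷ inorder r)

height : Tree → ℕ
height leaf = 0
height (node l y r) = suc (height l ⊔ height r)

data Depth (x : ℕ) : Tree → ℕ → Set where
  here  : ∀ {l r} → Depth x (node l x r) 0
  left  : ∀ {l y r d} → Depth x l d → Depth x (node l y r) (suc d)
  right : ∀ {l y r d} → Depth x r d → Depth x (node l y r) (suc d)

isLeaf : Tree → Bool
isLeaf leaf = true
isLeaf (node _ _ _) = false

data Dir : Set where
  L R : Dir

-- first key of the access history (most recent access FIRST) lying in the given key set
firstIn : List ℕ → List ℕ → Maybe ℕ
firstIn [] ks = nothing
firstIn (a ∷ h) ks with a ∈? ks
... | yes _ = just a
... | no  _ = firstIn h ks

prefDir : List ℕ → Tree → Maybe Dir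
prefDir h leaf = nothing
prefDir h t@(node l y r) with firstIn h (inorder t)
... | nothing = nothing
... | just a with a ≤? y
...   | yes _ = just L
...   | no  _ = just R

-- where the preferred path through the root of t continues
-- (just d: to the nonempty child in direction d; nothing: the path ends)
next : List ℕ → Tree → Maybe Dir
next h leaf = nothing
next h t@(node l y r) with prefDir h t | isLeaf l | isLeaf r
... | just L | false | _     = just L
... | just R | _     | false = just R
... | _      | _     | _     = nothing

-- the preferred path starting at the root of t: list of (key, direction to next node)
pathOf : List ℕ → Tree → List (ℕ × Maybe Dir)
pathOf h leaf = []
pathOf h t@(node l y r) with next h t
... | just L  = (y , just L) ∷ pathOf h l
... | just R  = (y , just R) ∷ pathOf h r
... | nothing = (y , nothing) ∷ []

-- the subtrees of P hanging off the preferred path through the root of t,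
-- listed in in-order (they fill the gaps between consecutive path keys)
hang : List ℕ → Tree → List Tree
hang h leaf = leaf ∷ []
hang h t@(node l y r) with next h t
... | just L  = hang h l ++ (r ∷ [])
... | just R  = l ∷ hang h r
... | nothing = l ∷ r ∷ []

-- Red-black trees: RB c bh t  (c = colour of root, bh = black height)
data Colour : Set where
  red black : Colour

data RB : Colour → ℕ → Tree → Set where
  rb-leaf  : RB black 0 leaf
  rb-black : ∀ {cl cr h l y r} → RB cl h l → RB cr h r → RB black (suc h) (node l y r)
  rb-red   : ∀ {h l y r} → RB black h l → RB black h r → RB red h (node l y r)

IsRedBlack : Tree → Set
IsRedBlack t = Σ Colour λ c → Σ ℕ λ bh → RB c bh t

-- TopChain j ps T : T consists of a top path made of the first j nodes of the
-- preferred path ps, linked exactly as in P (the other child being empty), with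
-- the remaining nodes of ps stored below the last top node as a red-black
-- tree (a BST on exactly those keys).
data TopChain : ℕ → List (ℕ × Maybe Dir) → Tree → Set where
  bottom  : ∀ {ps B} → IsRedBlack B → inorder B ↭ map proj₁ ps → TopChain 0 ps B
  chain-L : ∀ {j y ps B} → TopChain j ps B → TopChain (suc j) ((y , just L) ∷ ps) (node B y leaf)
  chain-R : ∀ {j y ps B} → TopChain j ps B → TopChain (suc j) ((y , just R) ∷ ps) (node leaf y B)
  chain-E : ∀ {y} → TopChain 1 ((y , nothing) ∷ []) (node leaf y leaf)

-- representation of a preferred path ps, with parameter m = log log n:
-- top path of length (number of nodes) j ≤ 3m, and either no bottom tree
-- (j = |ps|) or a nonempty bottom tree and m ≤ j.
IsPathRep : ℕ → List (ℕ × Maybe Dir) → Tree → Set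
IsPathRep m ps T = Σ ℕ λ j → TopChain j ps T × j ≤ 3 * m
                    × (j ≡ length ps ⊎ (m ≤ j × j < length ps))

fill : Tree → List Tree → Tree × List Tree
fill leaf [] = leaf , []
fill leaf (t ∷ ts) = t , ts
fill (node l y r) ts with fill l ts
... | l' , ts₁ with fill r ts₁
...   | r' , ts₂ = node l' y r' , ts₂

-- Hybrid h m t T : T is a hybrid tree representing the preferred paths of the
-- subtree t of P (preferred children determined by access history h), with
-- m = log log n.  The representation R of the preferred path through the root
-- of t has its empty leaves (in in-order) replaced by the hybrid trees of the
-- hanging subtrees; T is a BST on the keys of t.
data Hybrid (h : List ℕ) (m : ℕ) : Tree → Tree → Set where
  hy-leaf : Hybrid h m leaf leaf
  hy-node : ∀ {l y r Rp Ts T} →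
            IsPathRep m (pathOf h (node l y r)) Rp →
            Pointwise (Hybrid h m) (hang h (node l y r)) Ts →
            T ≡ proj₁ (fill Rp Ts) →
            inorder T ≡ inorder (node l y r) →
            Hybrid h m (node l y r) T

loglog : ℕ → ℕ
loglog n = ⌊log₂ ⌊log₂ n ⌋ ⌋

-- A key on the top path of a preferred path has the same depth in the hybrid tree T as in the
-- reference tree P.  The bottom tree of a path lies below at least log log n top nodes and
-- holds at most height P = O(log n) keys, so as a red-black tree it has height O(log log n);
-- hence its keys, and the leaves where the representations of the hanging subtrees are
-- attached, have T-depth at most 5 times their P-depth.  Induction over the hanging subtrees
-- gives d_T(x) ≤ 5 (d_P(x) + 1), and by minimality P has height at most ⌊log₂ n⌋ + 1.

module Submission where

open import Defs
open import Data.Nat using (ℕ; zero; suc; _+_; _*_; _^_; _≤_; _<_; _⊔_; z≤n; s≤s; _<?_)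
open import Data.Nat.Properties
open import Data.Nat.Logarithm using (⌊log₂_⌋; ⌊log₂⌋-mono-≤; ⌊log₂[2^n]⌋≡n)
open import Data.Nat.Tactic.RingSolver using (solve-∀)
open import Data.List using (List; []; _∷_; _++_; length; map)
open import Data.List.Properties using (length-++; length-map; ++-assoc; ++-identityʳ)
open import Data.List.Membership.Propositional using (_∈_)
open import Data.List.Membership.Propositional.Properties using (∈-++⁺ˡ; ∈-++⁺ʳ)
open import Data.List.Relation.Unary.Any using (here; there)
open import Data.List.Relation.Unary.All as All using (All; []; _∷_)
import Data.List.Relation.Unary.All.Properties as All
open import Data.List.Relation.Unary.AllPairs using (AllPairs; []; _∷_)
open import Data.List.Relation.Unary.Linked using (Linked)
open import Data.List.Relation.Unary.Linked.Properties using (Linked⇒AllPairs)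
open import Data.List.Relation.Binary.Pointwise as Pointwise using (Pointwise; []; _∷_)
open import Data.List.Relation.Binary.Permutation.Propositional using (_↭_)
open import Data.List.Relation.Binary.Permutation.Propositional.Properties using (∈-resp-↭; ↭-length)
open import Data.Maybe using (Maybe; just; nothing)
open import Data.Product using (Σ; _×_; _,_; proj₁; proj₂)
open import Data.Sum using (_⊎_; inj₁; inj₂; map₂)
open import Relation.Nullary using (yes; no; contradiction)
open import Relation.Binary.PropositionalEquality

n<2^[1+⌊log₂n⌋] : ∀ n → n < 2 ^ suc ⌊log₂ n ⌋
n<2^[1+⌊log₂n⌋] n with n <? 2 ^ suc ⌊log₂ n ⌋
... | yes n< = n<
... | no n≮ = contradiction (subst (_≤ ⌊log₂ n ⌋) (⌊log₂[2^n]⌋≡n _) (⌊log₂⌋-mono-≤ (≮⇒≥ n≮))) 1+n≰n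

2+n≤2^[2+⌊log₂n⌋] : ∀ n → 2 + n ≤ 2 ^ (2 + ⌊log₂ n ⌋)
2+n≤2^[2+⌊log₂n⌋] n = begin
  2 + n     ≤⟨ s≤s (n<2^[1+⌊log₂n⌋] n) ⟩
  1 + A     ≤⟨ +-monoˡ-≤ A (m^n>0 2 (suc ⌊log₂ n ⌋)) ⟩
  A + A     ≡⟨ cong (A +_) (sym (+-identityʳ A)) ⟩
  2 * A     ∎
  where
  open ≤-Reasoning
  A = 2 ^ suc ⌊log₂ n ⌋

2^-cancel-≤ : ∀ {a b} → 2 ^ a ≤ 2 ^ b → a ≤ b
2^-cancel-≤ {a} {b} le = subst₂ _≤_ (⌊log₂[2^n]⌋≡n a) (⌊log₂[2^n]⌋≡n b) (⌊log₂⌋-mono-≤ le)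

size : Tree → ℕ
size t = length (inorder t)

size-node : ∀ l y r → size (node l y r) ≡ size l + suc (size r)
size-node l y r = length-++ (inorder l)

size≡0⇒leaf : ∀ t → size t ≡ 0 → t ≡ leaf
size≡0⇒leaf leaf _ = refl
size≡0⇒leaf (node l y r) eq = contradiction (trans (sym (+-suc _ _)) (trans (sym (size-node l y r)) eq)) 1+n≢0

height-left : ∀ l y r → height l ≤ height (node l y r)
height-left l y r = m≤n⇒m≤1+n (m≤m⊔n (height l) (height r))

height-right : ∀ l y r → height r ≤ height (node l y r)
height-right l y r = m≤n⇒m≤1+n (m≤n⊔m (height l) (height r))

depth∈inorder : ∀ {x t d} → Depth x t d → x ∈ inorder t
depth∈inorder {t = node l _ _} here = ∈-++⁺ʳ (inorder l) (here refl)
depth∈inorder {t = node _ _ _} (left p) = ∈-++⁺ˡ (depth∈inorder p)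
depth∈inorder {t = node l _ _} (right p) = ∈-++⁺ʳ (inorder l) (there (depth∈inorder p))

depth<height : ∀ {x t d} → Depth x t d → d < height t
depth<height here = s≤s z≤n
depth<height {t = node l _ r} (left p) = s≤s (≤-trans (depth<height p) (m≤m⊔n (height l) (height r)))
depth<height {t = node l _ r} (right p) = s≤s (≤-trans (depth<height p) (m≤n⊔m (height l) (height r)))

depths<⇒height≤ : ∀ t K → (∀ {x d} → Depth x t d → d < K) → height t ≤ K
depths<⇒height≤ leaf K _ = z≤n
depths<⇒height≤ (node l y r) zero bound = contradiction (bound here) λ ()
depths<⇒height≤ (node l y r) (suc K) bound = s≤s (⊔-lub
  (depths<⇒height≤ l K (λ p → ≤-pred (bound (left p))))
  (depths<⇒height≤ r K (λ p → ≤-pred (bound (right p)))))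

mutual
  height-≤-2*bh : ∀ {bh B} → RB black bh B → height B ≤ 2 * bh
  height-≤-2*bh rb-leaf = z≤n
  height-≤-2*bh (rb-black {h = bh} l r) =
    ≤-trans (s≤s (⊔-lub (height-≤-1+2*bh l) (height-≤-1+2*bh r))) (≤-reflexive (sym (*-suc 2 bh)))

  height-≤-1+2*bh : ∀ {c bh B} → RB c bh B → height B ≤ suc (2 * bh)
  height-≤-1+2*bh rb-leaf = z≤n
  height-≤-1+2*bh rb@(rb-black _ _) = m≤n⇒m≤1+n (height-≤-2*bh rb)
  height-≤-1+2*bh (rb-red l r) = s≤s (⊔-lub (height-≤-2*bh l) (height-≤-2*bh r))

2^bh≤1+size : ∀ {c bh B} → RB c bh B → 2 ^ bh ≤ suc (size B)
2^bh≤1+size rb-leaf = ≤-refl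
2^bh≤1+size (rb-black {h = bh} {l = l} {y} {r} a b) = subst (2 ^ suc bh ≤_) (cong suc (sym (size-node l y r)))
  (+-mono-≤ (2^bh≤1+size a) (≤-trans (≤-reflexive (+-identityʳ _)) (2^bh≤1+size b)))
2^bh≤1+size (rb-red {l = l} {y} {r} a b) = ≤-trans (2^bh≤1+size a)
  (s≤s (≤-trans (m≤m+n (size l) _) (≤-reflexive (sym (size-node l y r)))))

redBlack-height-≤ : ∀ {B} k → IsRedBlack B → suc (size B) ≤ 2 ^ k → height B ≤ suc (2 * k)
redBlack-height-≤ k (_ , bh , rb) small =
  ≤-trans (height-≤-1+2*bh rb) (s≤s (*-monoʳ-≤ 2 (2^-cancel-≤ {bh} {k} (≤-trans (2^bh≤1+size rb) small))))

perfect : ℕ → List ℕ → Tree × List ℕ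
perfect zero xs = leaf , xs
perfect (suc k) xs with perfect k xs
... | l , [] = l , []
... | l , y ∷ ys with perfect k ys
...   | r , zs = node l y r , zs

record PerfectPrefix (k : ℕ) (xs : List ℕ) (t : Tree) (rest : List ℕ) : Set where
  field
    splits   : inorder t ++ rest ≡ xs
    height≤  : height t ≤ k
    complete : rest ≡ [] ⊎ 2 ^ k ≤ suc (size t)

perfect-prefix : ∀ k xs → PerfectPrefix k xs (proj₁ (perfect k xs)) (proj₂ (perfect k xs))
perfect-prefix zero xs = record { splits = refl ; height≤ = z≤n ; complete = inj₂ ≤-refl }
perfect-prefix (suc k) xs with perfect k xs | perfect-prefix k xs
... | l , [] | l-ok = record { splits = L.splits ; height≤ = m≤n⇒m≤1+n L.height≤ ; complete = inj₁ refl }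
  where module L = PerfectPrefix l-ok
... | l , y ∷ ys | l-ok with perfect k ys | perfect-prefix k ys
...   | r , zs | r-ok = record
  { splits   = trans (++-assoc (inorder l) (y ∷ inorder r) zs)
                     (trans (cong (λ u → inorder l ++ y ∷ u) R.splits) L.splits)
  ; height≤  = s≤s (⊔-lub L.height≤ R.height≤)
  ; complete = complete L.complete R.complete
  }
  where
  module L = PerfectPrefix l-ok
  module R = PerfectPrefix r-ok
  complete : y ∷ ys ≡ [] ⊎ 2 ^ k ≤ suc (size l) → zs ≡ [] ⊎ 2 ^ k ≤ suc (size r) →
             zs ≡ [] ⊎ 2 ^ suc k ≤ suc (size (node l y r))
  complete _ (inj₁ zs≡[]) = inj₁ zs≡[]
  complete (inj₂ full-l) (inj₂ full-r) = inj₂ (begin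
    2 ^ suc k                   ≡⟨ cong (2 ^ k +_) (+-identityʳ (2 ^ k)) ⟩
    2 ^ k + 2 ^ k               ≤⟨ +-mono-≤ full-l full-r ⟩
    suc (size l) + suc (size r) ≡⟨ cong suc (sym (size-node l y r)) ⟩
    suc (size (node l y r))     ∎)
    where open ≤-Reasoning

balanced : ∀ k xs → length xs < 2 ^ k → Σ Tree λ t → inorder t ≡ xs × height t ≤ k
balanced k xs short with perfect k xs | perfect-prefix k xs
... | t , [] | record { splits = splits ; height≤ = height≤ } =
  t , trans (sym (++-identityʳ (inorder t))) splits , height≤
... | t , z ∷ zs | record { splits = refl ; complete = inj₂ full } =
  contradiction (≤-trans short (≤-trans full too-long)) 1+n≰n
  where
  too-long : suc (size t) ≤ length (inorder t ++ z ∷ zs)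
  too-long = subst (suc (size t) ≤_) (sym (length-++ (inorder t))) (m<m+n (size t) (s≤s z≤n))

minimal-height-≤ : ∀ t → (∀ u → inorder u ≡ inorder t → height t ≤ height u) →
                   height t ≤ suc ⌊log₂ size t ⌋
minimal-height-≤ t minimal with balanced (suc ⌊log₂ size t ⌋) (inorder t) (n<2^[1+⌊log₂n⌋] (size t))
... | u , same , low = ≤-trans (minimal u same) low

AllPairs-++⁻ : ∀ {R : ℕ → ℕ → Set} xs {ys} → AllPairs R (xs ++ ys) →
               AllPairs R xs × AllPairs R ys × All (λ x → All (R x) ys) xs
AllPairs-++⁻ [] sorted = [] , sorted , []
AllPairs-++⁻ (x ∷ xs) (x~ ∷ sorted) with AllPairs-++⁻ xs sorted | All.++⁻ xs x~
... | xs-ok , ys-ok , xs~ys | x~xs , x~ys = (x~xs ∷ xs-ok) , ys-ok , (x~ys ∷ xs~ys)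

depth-unique : ∀ {t x d₁ d₂} → AllPairs _<_ (inorder t) → Depth x t d₁ → Depth x t d₂ → d₁ ≡ d₂
depth-unique {node l y r} sorted p q with AllPairs-++⁻ (inorder l) sorted
... | sorted-l , (y<r ∷ sorted-r) , l<y∷r = go p q
  where
  <y : ∀ {x d} → Depth x l d → x < y
  <y p = All.lookup (All.lookup l<y∷r (depth∈inorder p)) (here refl)
  y< : ∀ {x d} → Depth x r d → y < x
  y< p = All.lookup y<r (depth∈inorder p)
  go : ∀ {x d₁ d₂} → Depth x (node l y r) d₁ → Depth x (node l y r) d₂ → d₁ ≡ d₂
  go here      here      = refl
  go (left p)  (left q)  = cong suc (depth-unique sorted-l p q)
  go (right p) (right q) = cong suc (depth-unique sorted-r p q)
  go here      (left q)  = contradiction (<y q) (<-irrefl refl)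
  go here      (right q) = contradiction (y< q) (<-irrefl refl)
  go (left p)  here      = contradiction (<y p) (<-irrefl refl)
  go (right p) here      = contradiction (y< p) (<-irrefl refl)
  go (left p)  (right q) = contradiction (<y p) (<-asym (y< q))
  go (right p) (left q)  = contradiction (<y q) (<-asym (y< p))

Embedding : Tree → ℕ → Tree → Set
Embedding u g t = ∀ {x e} → Depth x u e → Depth x t (g + e)

Embedding-child : ∀ {u t t₀ o} → Embedding u 1 t → Embedding t o t₀ → Embedding u (suc o) t₀
Embedding-child {o = o} child emb p = subst (Depth _ _) (+-suc o _) (emb (child p))

Embedding-trans : ∀ {u t t₀ g o} → Embedding u g t → Embedding t o t₀ → Embedding u (o + g) t₀
Embedding-trans {g = g} {o} emb₁ emb₂ p = subst (Depth _ _) (sym (+-assoc o g _)) (emb₂ (emb₁ p))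

Below : Tree → Tree → Set
Below t u = Σ ℕ λ g → Embedding u (suc g) t

Below-child : ∀ {t t′ u} → Embedding t 1 t′ → Below t u → Below t′ u
Below-child child (g , emb) = suc g , Embedding-trans emb child

Embedding-height : ∀ {u g t} → Embedding u g t → height u ≤ height t
Embedding-height {u} {g} emb = depths<⇒height≤ u _ λ {_} {e} p → ≤-trans (s≤s (m≤n+m e g)) (depth<height (emb p))

leafDepths : ℕ → Tree → List ℕ
leafDepths k leaf = k ∷ []
leafDepths k (node l _ r) = leafDepths (suc k) l ++ leafDepths (suc k) r

leafDepths-length : ∀ k t → length (leafDepths k t) ≡ suc (size t)
leafDepths-length k leaf = refl
leafDepths-length k (node l y r) = begin
  length (leafDepths (suc k) l ++ leafDepths (suc k) r)         ≡⟨ length-++ (leafDepths (suc k) l) ⟩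
  length (leafDepths (suc k) l) + length (leafDepths (suc k) r) ≡⟨ cong₂ _+_ (leafDepths-length _ l)
                                                                              (leafDepths-length _ r) ⟩
  suc (size l) + suc (size r)                                   ≡⟨ cong suc (size-node l y r) ⟨
  suc (size (node l y r))                                       ∎
  where open ≡-Reasoning

leafDepths-≤ : ∀ k t → All (_≤ k + height t) (leafDepths k t)
leafDepths-≤ k leaf = m≤m+n k 0 ∷ []
leafDepths-≤ k (node l y r) = All.++⁺ (All.map (λ D≤ → ≤-trans D≤ (below (m≤m⊔n _ _))) (leafDepths-≤ (suc k) l))
                                       (All.map (λ D≤ → ≤-trans D≤ (below (m≤n⊔m _ _))) (leafDepths-≤ (suc k) r))
  where
  below : ∀ {a} → a ≤ height l ⊔ height r → suc k + a ≤ k + height (node l y r)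
  below a≤ = ≤-trans (s≤s (+-monoʳ-≤ k a≤)) (≤-reflexive (sym (+-suc k _)))

module _ (Φ : ℕ → ℕ → Set) where

  Placed : ℕ → Tree → Set
  Placed k t = ∀ {x d} → Depth x t d → Φ x (k + d)

  Placed-node : ∀ {k l y r} → Φ y (k + 0) → Placed (suc k) l → Placed (suc k) r → Placed k (node l y r)
  Placed-node {k} φy φl φr here = φy
  Placed-node {k} φy φl φr (left p) = subst (Φ _) (sym (+-suc k _)) (φl p)
  Placed-node {k} φy φl φr (right p) = subst (Φ _) (sym (+-suc k _)) (φr p)

  Placed-left : ∀ {k l y r} → Placed k (node l y r) → Placed (suc k) l
  Placed-left {k} φ p = subst (Φ _) (+-suc k _) (φ (left p))

  Placed-right : ∀ {k l y r} → Placed k (node l y r) → Placed (suc k) r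
  Placed-right {k} φ p = subst (Φ _) (+-suc k _) (φ (right p))

  fill-Placed : ∀ t k {Ts Ds} → Placed k t → Pointwise Placed (leafDepths k t ++ Ds) Ts →
                Placed k (proj₁ (fill t Ts)) × Pointwise Placed Ds (proj₂ (fill t Ts))
  fill-Placed leaf k _ (φT ∷ φTs) = φT , φTs
  fill-Placed (node l y r) k {Ts} {Ds} φ φTs
    with fill l Ts | fill-Placed l (suc k) (Placed-left φ)
                       (subst (λ Es → Pointwise Placed Es Ts) (++-assoc (leafDepths (suc k) l) _ Ds) φTs)
  ... | l′ , Ts₁ | φl′ , φTs₁ with fill r Ts₁ | fill-Placed r (suc k) (Placed-right φ) φTs₁
  ...   | r′ , Ts₂ | φr′ , φTs₂ = Placed-node (φ here) φl′ φr′ , φTs₂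

module _ (h : List ℕ) where

  pathOf-length-≤ : ∀ t → length (pathOf h t) ≤ height t
  pathOf-length-≤ leaf = z≤n
  pathOf-length-≤ (node l y r) with next h (node l y r)
  ... | just L  = s≤s (≤-trans (pathOf-length-≤ l) (m≤m⊔n _ _))
  ... | just R  = s≤s (≤-trans (pathOf-length-≤ r) (m≤n⊔m _ _))
  ... | nothing = s≤s z≤n

  pathOf-node-nonempty : ∀ l y r → 1 ≤ length (pathOf h (node l y r))
  pathOf-node-nonempty l y r with next h (node l y r)
  ... | just L  = s≤s z≤n
  ... | just R  = s≤s z≤n
  ... | nothing = s≤s z≤n

  pathOf-depth : ∀ t {x} → x ∈ map proj₁ (pathOf h t) → Σ ℕ (Depth x t)
  pathOf-depth (node l y r) x∈ with next h (node l y r) | x∈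
  ... | just L  | here refl = 0 , here
  ... | just L  | there x∈l with pathOf-depth l x∈l
  ...   | d , p = suc d , left p
  pathOf-depth (node l y r) x∈ | just R  | here refl = 0 , here
  pathOf-depth (node l y r) x∈ | just R  | there x∈r with pathOf-depth r x∈r
  ...   | d , p = suc d , right p
  pathOf-depth (node l y r) x∈ | nothing | here refl = 0 , here

  hang-length : ∀ t → length (hang h t) ≡ suc (length (pathOf h t))
  hang-length leaf = refl
  hang-length (node l y r) with next h (node l y r)
  ... | just L  = trans (length-++ (hang h l)) (trans (+-comm _ 1) (cong suc (hang-length l)))
  ... | just R  = cong suc (hang-length r)
  ... | nothing = refl

  -- The hanging leaf of a leaf embeds vacuously at any offset.
  hang-Below : ∀ t → All (Below t) (hang h t)
  hang-Below leaf = (0 , λ ()) ∷ []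
  hang-Below (node l y r) with next h (node l y r)
  ... | just L  = All.++⁺ (All.map (Below-child left) (hang-Below l)) ((0 , right) ∷ [])
  ... | just R  = (0 , left) ∷ All.map (Below-child right) (hang-Below r)
  ... | nothing = (0 , left) ∷ (0 , right) ∷ []

  -- Bundled so that it survives the with-abstraction over next h t in chain-Placed.
  record PathFacts (t : Tree) (ps : List (ℕ × Maybe Dir)) (hs : List Tree) : Set where
    field
      depth     : ∀ {x} → x ∈ map proj₁ ps → Σ ℕ (Depth x t)
      length-≤  : length ps ≤ height t
      nonempty  : 1 ≤ length ps
      hangs     : length hs ≡ suc (length ps)
      embedding : All (Below t) hs

  pathFacts : ∀ l y r → PathFacts (node l y r) (pathOf h (node l y r)) (hang h (node l y r))
  pathFacts l y r = record
    { depth     = pathOf-depth (node l y r)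
    ; length-≤  = pathOf-length-≤ (node l y r)
    ; nonempty  = pathOf-node-nonempty l y r
    ; hangs     = hang-length (node l y r)
    ; embedding = hang-Below (node l y r)
    }

Shallow : Tree → ℕ → ℕ → Set
Shallow t x d = Σ ℕ λ dP → Depth x t dP × d ≤ 5 * suc dP

HangsAt : Tree → ℕ → Tree → Set
HangsAt t D u = Σ ℕ λ G → D ≤ 5 * G × Embedding u G t

Shallow-shift : ∀ {t u D G x d} → D ≤ 5 * G → Embedding u G t → Shallow u x d → Shallow t x (D + d)
Shallow-shift {D = D} {G} {d = d} D≤ emb (dP , p , d≤) = G + dP , emb p , (begin
  D + d               ≤⟨ +-mono-≤ D≤ d≤ ⟩
  5 * G + 5 * suc dP  ≡⟨ *-distribˡ-+ 5 G (suc dP) ⟨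
  5 * (G + suc dP)    ≡⟨ cong (5 *_) (+-suc G dP) ⟩
  5 * suc (G + dP)    ∎)
  where open ≤-Reasoning

root-Shallow : ∀ {t l y r o} → Embedding (node l y r) o t → Shallow t y (o + 0)
root-Shallow emb = _ , emb here , ≤-trans (n≤1+n _) (m≤n*m _ 5)

bottom-bound : ∀ {m o D} g → m ≤ o → D ≤ o + suc (2 * (2 + m)) → D ≤ 5 * (o + suc g)
bottom-bound {m} {o} {D} g m≤o D≤ = begin
  D                               ≤⟨ D≤ ⟩
  o + suc (2 * (2 + m))           ≤⟨ +-monoʳ-≤ o (s≤s (*-monoʳ-≤ 2 (+-monoʳ-≤ 2 m≤o))) ⟩
  o + suc (2 * (2 + o))           ≤⟨ m≤m+n _ (2 * o) ⟩
  o + suc (2 * (2 + o)) + 2 * o   ≡⟨ five-fold o ⟩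
  5 * (o + 1)                     ≤⟨ *-monoʳ-≤ 5 (+-monoʳ-≤ o (s≤s z≤n)) ⟩
  5 * (o + suc g)                 ∎
  where
  open ≤-Reasoning
  five-fold : ∀ o → o + suc (2 * (2 + o)) + 2 * o ≡ 5 * (o + 1)
  five-fold = solve-∀

Pointwise-fromAll : ∀ {A B : Set} {P : A → Set} {Q : B → Set} {R : A → B → Set} {xs ys} →
                    length xs ≡ length ys → All P xs → All Q ys → (∀ {x y} → P x → Q y → R x y) →
                    Pointwise R xs ys
Pointwise-fromAll {xs = []}    {[]}    _   []       []       _ = []
Pointwise-fromAll {xs = _ ∷ _} {_ ∷ _} len (px ∷ pxs) (qy ∷ qys) f =
  f px qy ∷ Pointwise-fromAll (suc-injective len) pxs qys f

-- H bounds the height of the reference tree, hence the size of every bottom tree.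
module _ (h : List ℕ) (m H : ℕ) (room : suc H ≤ 2 ^ (2 + m)) where

  -- o + j is the length of the whole top path, invariant while descending it.
  descend : ∀ {o j n} → suc j ≡ suc n ⊎ m ≤ o + suc j → j ≡ n ⊎ m ≤ suc o + j
  descend (inj₁ eq) = inj₁ (suc-injective eq)
  descend {o} {j} (inj₂ m≤) = inj₂ (subst (m ≤_) (+-suc o j) m≤)

  module _ {t₀ : Tree} where

    bottom-Placed : ∀ {t o ps hs B} → PathFacts h t ps hs → Embedding t o t₀ →
                    IsRedBlack B → inorder B ↭ map proj₁ ps → 0 ≡ length ps ⊎ m ≤ o + 0 → height t ≤ H →
                    Placed (Shallow t₀) o B × Pointwise (HangsAt t₀) (leafDepths o B) hs
    bottom-Placed {t} {o} {ps} {hs} {B} facts emb rb B↭ps deep ht = keys , hanging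
      where
      open PathFacts facts
      deep⇒m≤o : 0 ≡ length ps ⊎ m ≤ o + 0 → m ≤ o
      deep⇒m≤o (inj₁ 0≡) = contradiction (subst (1 ≤_) (sym 0≡) nonempty) λ ()
      deep⇒m≤o (inj₂ m≤) = subst (m ≤_) (+-identityʳ o) m≤
      m≤o : m ≤ o
      m≤o = deep⇒m≤o deep
      size-B : size B ≡ length ps
      size-B = trans (↭-length B↭ps) (length-map proj₁ ps)
      low : height B ≤ suc (2 * (2 + m))
      low = redBlack-height-≤ (2 + m) rb (≤-trans (s≤s (≤-trans (≤-reflexive size-B) (≤-trans length-≤ ht))) room)
      keys : Placed (Shallow t₀) o B
      keys {x} {d} p with depth (∈-resp-↭ B↭ps (depth∈inorder p))
      ... | dP , q = o + dP , emb q , subst (o + d ≤_) (cong (5 *_) (+-suc o dP))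
                       (bottom-bound dP m≤o (+-monoʳ-≤ o (≤-trans (<⇒≤ (depth<height p)) low)))
      hanging : Pointwise (HangsAt t₀) (leafDepths o B) hs
      hanging = Pointwise-fromAll (trans (leafDepths-length o B) (trans (cong suc size-B) (sym hangs)))
                  (leafDepths-≤ o B) embedding
                  (λ D≤ (g , emb′) → o + suc g , bottom-bound g m≤o (≤-trans D≤ (+-monoʳ-≤ o low)) , Embedding-trans emb′ emb)

    -- t lies at depth o of t₀, and Rp, representing the rest of its preferred path, hangs at depth o too.
    chain-Placed : ∀ t o {j Rp} → Embedding t o t₀ → TopChain j (pathOf h t) Rp →
                   j ≡ length (pathOf h t) ⊎ m ≤ o + j → height t ≤ H →
                   Placed (Shallow t₀) o Rp × Pointwise (HangsAt t₀) (leafDepths o Rp) (hang h t)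
    chain-Placed leaf o _ (bottom {B = B} _ B↭[]) _ _ with size≡0⇒leaf B (↭-length B↭[])
    ... | refl = (λ ()) , (o , m≤n*m o 5 , λ ()) ∷ []
    chain-Placed (node l y r) o emb tc deep ht with next h (node l y r) | pathFacts h l y r
    ... | just L | facts with tc
    ...   | bottom rb B↭ps = bottom-Placed facts emb rb B↭ps deep ht
    ...   | chain-L tc′
      with chain-Placed l (suc o) (Embedding-child left emb) tc′ (descend deep) (≤-trans (height-left l y r) ht)
    ...     | keys , hanging = Placed-node (Shallow t₀) {o} (root-Shallow emb) keys (λ ()) ,
                               Pointwise.++⁺ hanging ((suc o , m≤n*m _ 5 , Embedding-child right emb) ∷ [])
    chain-Placed (node l y r) o emb tc deep ht | just R | facts with tc
    ...   | bottom rb B↭ps = bottom-Placed facts emb rb B↭ps deep ht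
    ...   | chain-R tc′
      with chain-Placed r (suc o) (Embedding-child right emb) tc′ (descend deep) (≤-trans (height-right l y r) ht)
    ...     | keys , hanging = Placed-node (Shallow t₀) {o} (root-Shallow emb) (λ ()) keys ,
                               (suc o , m≤n*m _ 5 , Embedding-child left emb) ∷ hanging
    chain-Placed (node l y r) o emb tc deep ht | nothing | facts with tc
    ...   | bottom rb B↭ps = bottom-Placed facts emb rb B↭ps deep ht
    ...   | chain-E = Placed-node (Shallow t₀) {o} (root-Shallow emb) (λ ()) (λ ()) ,
                      (suc o , m≤n*m _ 5 , Embedding-child left emb) ∷ (suc o , m≤n*m _ 5 , Embedding-child right emb) ∷ []

  mutual
    hybrid-Shallow : ∀ {t T} → Hybrid h m t T → height t ≤ H → Placed (Shallow t) 0 T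
    hybrid-Shallow hy-leaf _ ()
    hybrid-Shallow {t} (hy-node {Rp = Rp} {Ts} (_ , tc , _ , len) hybrids refl _) ht
      with chain-Placed t 0 (λ p → p) tc (map₂ proj₁ len) ht
    ... | keys , hanging = proj₁ (fill-Placed (Shallow t) Rp 0 keys
            (subst (λ Ds → Pointwise _ Ds Ts) (sym (++-identityʳ _)) (hybrids-Placed ht hanging hybrids)))

    hybrids-Placed : ∀ {t Ds us Ts} → height t ≤ H → Pointwise (HangsAt t) Ds us → Pointwise (Hybrid h m) us Ts →
                     Pointwise (Placed (Shallow t)) Ds Ts
    hybrids-Placed ht [] [] = []
    hybrids-Placed ht ((_ , D≤ , emb) ∷ hangs) (hybrid ∷ hybrids) =
      (λ p → Shallow-shift D≤ emb (hybrid-Shallow hybrid (≤-trans (Embedding-height emb) ht) p)) ∷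
      hybrids-Placed ht hangs hybrids

Shallow-≤ : ∀ {t x d dP} → AllPairs _<_ (inorder t) → Shallow t x d → Depth x t dP → d ≤ 5 * suc dP
Shallow-≤ sorted (_ , p , d≤) q rewrite depth-unique sorted p q = d≤

Shallow-≤-height : ∀ {t x d} → Shallow t x d → d ≤ 5 * height t
Shallow-≤-height (_ , p , d≤) = ≤-trans d≤ (*-monoʳ-≤ 5 (depth<height p))

minimal-Shallow : ∀ P {hist T} → (∀ Q → inorder Q ≡ inorder P → height P ≤ height Q) →
                  Hybrid hist (loglog (size P)) P T → Placed (Shallow P) 0 T
minimal-Shallow P minimal hybrid = hybrid-Shallow _ _ (height P)
  (≤-trans (s≤s (minimal-height-≤ P minimal)) (2+n≤2^[2+⌊log₂n⌋] _)) hybrid ≤-refl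

lemma1 : Σ ℕ λ c →
           (S : List ℕ) → Linked _<_ S →
           (P : Tree) → inorder P ≡ S →
           ((Q : Tree) → inorder Q ≡ S → height P ≤ height Q) →
           (hist : List ℕ) → All (λ a → a ∈ S) hist →
           (T : Tree) → Hybrid hist (loglog (length S)) P T →
           ((x dT dP : ℕ) → Depth x T dT → Depth x P dP → dT ≤ c * suc dP)
           × (height T ≤ c * suc ⌊log₂ length S ⌋)
lemma1 = 6 , λ where
  _ linked P refl minimal _ _ T hybrid →
    let shallow = minimal-Shallow P minimal hybrid
        lg = ⌊log₂ size P ⌋
    in (λ _ _ dP pT pP → ≤-trans (Shallow-≤ (Linked⇒AllPairs <-trans linked) (shallow pT) pP)
                                 (*-monoˡ-≤ (suc dP) (n≤1+n 5)))
     , depths<⇒height≤ T (6 * suc lg) λ pT →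
         s≤s (≤-trans (Shallow-≤-height (shallow pT))
                      (≤-trans (*-monoʳ-≤ 5 (minimal-height-≤ P minimal)) (m≤n+m _ lg)))
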